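{- Let $G$ and $H$ be two non-trivial connected graphs of order $n_1$ and $n_2$, having $t_1$ and $t_2$ true twin equivalence classes, respectively. Then: (i) If $\dim_l(G)=n_1-t_1$ and $\dim_l(H)=n_2-t_2$, then $\dim_l(G\boxtimes H)= n_1n_2-t_1t_2$. (ii) If $\dim_l(G)=n_1-t_1$ and $H$ is bipartite, then $n_2(n_1-t_1)\le \dim_l(G\boxtimes H)\le n_2(n_1-t_1)+t_1$.
   Context: Two vertices $u,v$ are true twins if $N_G[u]=N_G[v]$ (closed neighborhoods); the true twin equivalence classes are the classes of the relation $N_G[x]=N_G[y]$. A set $S$ is a local metric generator for a connected graph $G$ if for every two adjacent vertices $x,y$ there is $s\in S$ with $d_G(s,x)\ne d_G(s,y)$; $\dim_l(G)$ is the minimum cardinality of a local metric generator. The strong product $G\boxtimes H$ has vertex set $V(G)\times V(H)$, with $(a,b)\sim(c,d)$ iff ($a=c$ and $b\sim d$) or ($b=d$ and $a\sim c$) or ($a\sim c$ and $b\sim d$). -}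

module Defs where

open import Data.Nat using (ℕ; zero; suc; _≤_; _<ᵇ_; _*_)
open import Data.Bool using (Bool; true; false; _∧_; _∨_; not)
import Data.Bool as B
open import Data.Fin using (Fin; toℕ; remQuot)
import Data.Fin as F
open import Data.Fin.Subset using (Subset; _∈_; ∣_∣)
open import Data.Vec using (tabulate)
open import Data.Vec.Properties using (≡-dec)
open import Data.List using (List; allFin)
open import Data.Bool.ListAction using (any)
open import Data.Product using (Σ; ∃; ∃₂; _×_; _,_; proj₁; proj₂)
open import Relation.Binary.PropositionalEquality using (_≡_; _≢_)
open import Relation.Nullary using (¬_)
open import Relation.Nullary.Decidable using (⌊_⌋)

Adj : ℕ → Set
Adj n = Fin n → Fin n → Bool

SimpleGraph : ∀ {n} → Adj n → Set
SimpleGraph {n} A = (∀ u v → A u v ≡ A v u) × (∀ u → A u u ≡ false)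

data Walk {n} (A : Adj n) : Fin n → Fin n → ℕ → Set where
  here : ∀ {u} → Walk A u u zero
  step : ∀ {u w v k} → A u w ≡ true → Walk A w v k → Walk A u v (suc k)

Connected : ∀ {n} → Adj n → Set
Connected {n} A = ∀ (u v : Fin n) → ∃ λ k → Walk A u v k

Dist : ∀ {n} → Adj n → Fin n → Fin n → ℕ → Set
Dist A u v k = Walk A u v k × (∀ m → Walk A u v m → k ≤ m)

LocalMetricGen : ∀ {n} → Adj n → Subset n → Set
LocalMetricGen {n} A S =
  ∀ (x y : Fin n) → A x y ≡ true →
    Σ (Fin n) λ s → s ∈ S × ∃₂ λ k l → Dist A s x k × Dist A s y l × k ≢ l

IsLocalMetricDim : ∀ {n} → Adj n → ℕ → Set
IsLocalMetricDim {n} A d =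
  (Σ (Subset n) λ S → LocalMetricGen A S × ∣ S ∣ ≡ d)
  × (∀ S → LocalMetricGen A S → d ≤ ∣ S ∣)

closedNbhd : ∀ {n} → Adj n → Fin n → Subset n
closedNbhd A u = tabulate (λ v → ⌊ u F.≟ v ⌋ ∨ A u v)

trueTwinsᵇ : ∀ {n} → Adj n → Fin n → Fin n → Bool
trueTwinsᵇ A u v = ⌊ ≡-dec B._≟_ (closedNbhd A u) (closedNbhd A v) ⌋

isClassRep : ∀ {n} → Adj n → Fin n → Bool
isClassRep {n} A u = not (any (λ v → (toℕ v <ᵇ toℕ u) ∧ trueTwinsᵇ A v u) (allFin n))

trueTwinClasses : ∀ {n} → Adj n → ℕ
trueTwinClasses A = ∣ tabulate (isClassRep A) ∣

Bipartite : ∀ {n} → Adj n → Set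
Bipartite {n} A = Σ (Fin n → Bool) λ c → ∀ u v → A u v ≡ true → c u ≢ c v

-- strong product; vertex (a,b) is encoded as combine a b : Fin (n₁ * n₂)
_⊠_ : ∀ {n₁ n₂} → Adj n₁ → Adj n₂ → Adj (n₁ * n₂)
_⊠_ {n₁} {n₂} G H i j with remQuot {n₁} n₂ i | remQuot {n₁} n₂ j
... | (a , b) | (c , d) =
  (⌊ a F.≟ c ⌋ ∧ H b d) ∨ (⌊ b F.≟ d ⌋ ∧ G a c) ∨ (G a c ∧ H b d)

-- Lower bound: true twins are adjacent and equidistant from every other vertex, so a local
-- metric generator omits at most one vertex of each true twin class.  Vertices of G ⊠ H whose
-- coordinates are twins in G and in H are twins, so x ↦ (rep (π₁ x) , rep (π₂ x)) injects the
-- omitted vertices into a set of size t₁ t₂.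
-- Upper bound: if SG and SH are local metric generators of G and H, then
-- {(a , b) ∣ a ∈ SG or b ∈ SH} is one of G ⊠ H: every fibre G × {b} and {a} × H is isometric,
-- and the projections do not increase distances.  It omits (n₁ − ∣SG∣)(n₂ − ∣SH∣) vertices.
-- For (ii) take SH = {b₀}, which resolves every edge of the bipartite H by parity.

module Submission where

open import Defs
open import Data.Nat using (ℕ; zero; suc; _≤_; _<_; _*_; _∸_; _+_; z≤n; s≤s)
open import Data.Nat.Properties
open import Data.Nat.GeneralisedArithmetic using (iterate)
open import Data.Nat.Tactic.RingSolver using (solve-∀)
import Data.Nat.Induction as ℕᵢ
open import Data.Bool as Bool using (Bool; true; false; _∧_; _∨_; not)
open import Data.Bool.Properties using (¬-not; not-involutive; ∨-zeroʳ; T-≡; T-∧)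
open import Data.Bool.Solver using (module ∨-∧-Solver)
open import Data.Fin as Fin using (Fin; toℕ; fromℕ<; combine; remQuot)
import Data.Fin.Properties as Finₚ
import Data.Fin.Induction as Finᵢ
open import Data.Fin.Subset using (Subset; _∈_; _∉_; ∣_∣; ∁; ⁅_⁆; _-_; inside; outside)
open import Data.Fin.Subset.Properties
  using (∣p∣≤n; ∣⊥∣≡0; ∣∁p∣≡n∸∣p∣; ∣⁅x⁆∣≡1; x∈⁅x⁆; x∈p⇒x∉∁p; x∈∁p⇒x∉p; x∉p⇒x∈∁p;
         x∈p∧x≢y⇒x∈p-y; x∈p⇒∣p-x∣<∣p∣)
open import Data.Vec as Vec using ([]; _∷_; here; there; _++_; lookup; tabulate; _⊛*_)
open import Data.Vec.Properties
  using (lookup-⊛*; lookup-map; lookup∘tabulate; tabulate-cong; []=⇒lookup; lookup⇒[]=; map-id; map-const)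
open import Data.List using (allFin)
open import Data.List.Relation.Unary.Any using (satisfied)
open import Data.List.Relation.Unary.Any.Properties using (any⁻)
open import Data.Product using (Σ; ∃; ∃₂; _×_; _,_; proj₁; proj₂)
open import Data.Sum using (_⊎_; inj₁; inj₂)
open import Data.Empty using (⊥-elim)
open import Function using (_∘_; Equivalence)
open import Induction.WellFounded using (Acc; acc)
open import Relation.Binary using (tri<; tri≈; tri>)
open import Relation.Binary.PropositionalEquality
open import Relation.Nullary using (Dec; yes; no)
open import Relation.Nullary.Decidable using (⌊_⌋; isYes≗does; dec-true; dec-false; toWitness; _×-dec_)

private
  variable
    m n : ℕ

∧≡true⁻ : ∀ {x y} → x ∧ y ≡ true → x ≡ true × y ≡ true
∧≡true⁻ {true} {true} _ = refl , refl

⌊≟⌋-refl : (u : Fin n) → ⌊ u Fin.≟ u ⌋ ≡ true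
⌊≟⌋-refl u = trans (isYes≗does (u Fin.≟ u)) (dec-true (u Fin.≟ u) refl)

⌊≟⌋-≢ : {u v : Fin n} → u ≢ v → ⌊ u Fin.≟ v ⌋ ≡ false
⌊≟⌋-≢ {u = u} {v} u≢v = trans (isYes≗does (u Fin.≟ v)) (dec-false (u Fin.≟ v) u≢v)

⌊≟⌋-sym : (u v : Fin n) → ⌊ u Fin.≟ v ⌋ ≡ ⌊ v Fin.≟ u ⌋
⌊≟⌋-sym u v with u Fin.≟ v
... | yes refl = sym (⌊≟⌋-refl u)
... | no u≢v   = sym (⌊≟⌋-≢ (u≢v ∘ sym))

least-witness : {P : ℕ → Set} → (∀ k → Dec (P k)) → ∀ {k} → P k → ∃ λ j → P j × (∀ i → P i → j ≤ i)
least-witness {P} P? {k} = go (ℕᵢ.<-wellFounded k)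
  where
  go : ∀ {k} → Acc _<_ k → P k → ∃ λ j → P j × (∀ i → P i → j ≤ i)
  go {k} (acc smaller) pk with Finₚ.any? (λ (i : Fin k) → P? (toℕ i))
  ... | yes (i , pi) = go (smaller (Finₚ.toℕ<n i)) pi
  ... | no ∄ = k , pk , λ i pi → ≮⇒≥ λ i<k → ∄ (fromℕ< i<k , subst P (sym (Finₚ.toℕ-fromℕ< i<k)) pi)

n*[m∸o]≤m*n∸o*p : ∀ m n o p → p ≤ n → n * (m ∸ o) ≤ m * n ∸ o * p
n*[m∸o]≤m*n∸o*p m n o p p≤n = begin
  n * (m ∸ o)    ≡⟨ *-comm n (m ∸ o) ⟩
  (m ∸ o) * n    ≡⟨ *-distribʳ-∸ n m o ⟩
  m * n ∸ o * n  ≤⟨ ∸-monoʳ-≤ (m * n) (*-monoʳ-≤ o p≤n) ⟩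
  m * n ∸ o * p  ∎
  where open ≤-Reasoning

m*n∸o*[n∸1]≡n*[m∸o]+o : ∀ m n o → o ≤ m → 1 ≤ n → m * n ∸ o * (n ∸ 1) ≡ n * (m ∸ o) + o
m*n∸o*[n∸1]≡n*[m∸o]+o m (suc n) o o≤m _ = begin
  m * suc n ∸ o * n                          ≡⟨ cong (λ x → x * suc n ∸ o * n) (m+[n∸m]≡n o≤m) ⟨
  (o + (m ∸ o)) * suc n ∸ o * n              ≡⟨ cong (_∸ o * n) (expand o (m ∸ o) n) ⟩
  (suc n * (m ∸ o) + o) + o * n ∸ o * n      ≡⟨ m+n∸n≡m (suc n * (m ∸ o) + o) (o * n) ⟩
  suc n * (m ∸ o) + o                        ∎
  where
  open ≡-Reasoning
  expand : ∀ o e n → (o + e) * suc n ≡ (suc n * e + o) + o * n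
  expand = solve-∀

_×ˢ_ : Subset m → Subset n → Subset (m * n)
p ×ˢ q = Vec.map _∧_ p ⊛* q

∣p++q∣≡∣p∣+∣q∣ : (p : Subset m) (q : Subset n) → ∣ p ++ q ∣ ≡ ∣ p ∣ + ∣ q ∣
∣p++q∣≡∣p∣+∣q∣ []            q = refl
∣p++q∣≡∣p∣+∣q∣ (outside ∷ p) q = ∣p++q∣≡∣p∣+∣q∣ p q
∣p++q∣≡∣p∣+∣q∣ (inside  ∷ p) q = cong suc (∣p++q∣≡∣p∣+∣q∣ p q)

∣p×q∣≡∣p∣*∣q∣ : (p : Subset m) (q : Subset n) → ∣ p ×ˢ q ∣ ≡ ∣ p ∣ * ∣ q ∣
∣p×q∣≡∣p∣*∣q∣ [] q = refl
∣p×q∣≡∣p∣*∣q∣ {n = n} (outside ∷ p) q = begin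
  ∣ Vec.map (false ∧_) q ++ p ×ˢ q ∣      ≡⟨ ∣p++q∣≡∣p∣+∣q∣ (Vec.map (false ∧_) q) (p ×ˢ q) ⟩
  ∣ Vec.map (false ∧_) q ∣ + ∣ p ×ˢ q ∣  ≡⟨ cong₂ _+_ (trans (cong ∣_∣ (map-const q false)) (∣⊥∣≡0 n))
                                                      (∣p×q∣≡∣p∣*∣q∣ p q) ⟩
  ∣ p ∣ * ∣ q ∣                           ∎
  where open ≡-Reasoning
∣p×q∣≡∣p∣*∣q∣ (inside ∷ p) q = begin
  ∣ Vec.map (true ∧_) q ++ p ×ˢ q ∣      ≡⟨ ∣p++q∣≡∣p∣+∣q∣ (Vec.map (true ∧_) q) (p ×ˢ q) ⟩
  ∣ Vec.map (true ∧_) q ∣ + ∣ p ×ˢ q ∣   ≡⟨ cong₂ _+_ (cong ∣_∣ (map-id q)) (∣p×q∣≡∣p∣*∣q∣ p q) ⟩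
  ∣ q ∣ + ∣ p ∣ * ∣ q ∣                   ∎
  where open ≡-Reasoning

lookup-×ˢ : (p : Subset m) (q : Subset n) (a : Fin m) (b : Fin n) →
            lookup (p ×ˢ q) (combine a b) ≡ lookup p a ∧ lookup q b
lookup-×ˢ p q a b = trans (lookup-⊛* (Vec.map _∧_ p) q a b) (cong (λ f → f (lookup q b)) (lookup-map a _∧_ p))

x∈p×q⁺ : {p : Subset m} {q : Subset n} {a : Fin m} {b : Fin n} → a ∈ p → b ∈ q → combine a b ∈ p ×ˢ q
x∈p×q⁺ {p = p} {q} {a} {b} a∈p b∈q =
  lookup⇒[]= (combine a b) (p ×ˢ q) (trans (lookup-×ˢ p q a b) (cong₂ _∧_ ([]=⇒lookup a∈p) ([]=⇒lookup b∈q)))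

x∈p×q⁻ : {p : Subset m} {q : Subset n} {a : Fin m} {b : Fin n} → combine a b ∈ p ×ˢ q → a ∈ p × b ∈ q
x∈p×q⁻ {p = p} {q} {a} {b} ab∈p×q
  with pa , qb ← ∧≡true⁻ (trans (sym (lookup-×ˢ p q a b)) ([]=⇒lookup ab∈p×q))
  = lookup⇒[]= a p pa , lookup⇒[]= b q qb

x∈p⇒combine∈∁[∁p×∁q] : {p : Subset m} {q : Subset n} {x : Fin m} {y : Fin n} →
                        x ∈ p → combine x y ∈ ∁ (∁ p ×ˢ ∁ q)
x∈p⇒combine∈∁[∁p×∁q] {p = p} {q} x∈p = x∉p⇒x∈∁p (x∈p⇒x∉∁p x∈p ∘ proj₁ ∘ x∈p×q⁻ {p = ∁ p} {∁ q})

y∈q⇒combine∈∁[∁p×∁q] : {p : Subset m} {q : Subset n} {x : Fin m} {y : Fin n} →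
                        y ∈ q → combine x y ∈ ∁ (∁ p ×ˢ ∁ q)
y∈q⇒combine∈∁[∁p×∁q] {p = p} {q} y∈q = x∉p⇒x∈∁p (x∈p⇒x∉∁p y∈q ∘ proj₂ ∘ x∈p×q⁻ {p = ∁ p} {∁ q})

∣p∣≡n∸t⇒∣∁p∣≡t : ∀ {t} (p : Subset n) → ∣ p ∣ ≡ n ∸ t → t ≤ n → ∣ ∁ p ∣ ≡ t
∣p∣≡n∸t⇒∣∁p∣≡t {n} p ∣p∣≡n∸t t≤n = trans (∣∁p∣≡n∸∣p∣ p) (trans (cong (n ∸_) ∣p∣≡n∸t) (m∸[m∸n]≡n t≤n))

injectiveOn⇒∣p∣≤∣q∣ : {p : Subset m} {q : Subset n} (f : Fin m → Fin n) →
  (∀ {x} → x ∈ p → f x ∈ q) → (∀ {x y} → x ∈ p → y ∈ p → f x ≡ f y → x ≡ y) → ∣ p ∣ ≤ ∣ q ∣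
injectiveOn⇒∣p∣≤∣q∣ {p = []} f into inj = z≤n
injectiveOn⇒∣p∣≤∣q∣ {p = outside ∷ p} f into inj =
  injectiveOn⇒∣p∣≤∣q∣ (f ∘ Fin.suc) (into ∘ there) (λ x∈p y∈p → Finₚ.suc-injective ∘ inj (there x∈p) (there y∈p))
injectiveOn⇒∣p∣≤∣q∣ {p = inside ∷ p} {q} f into inj = ≤-<-trans ∣p∣≤∣q-f0∣ (x∈p⇒∣p-x∣<∣p∣ (into here))
  where
  ∣p∣≤∣q-f0∣ : ∣ p ∣ ≤ ∣ q - f Fin.zero ∣
  ∣p∣≤∣q-f0∣ = injectiveOn⇒∣p∣≤∣q∣ (f ∘ Fin.suc)
    (λ x∈p → x∈p∧x≢y⇒x∈p-y (into (there x∈p)) (λ eq → Finₚ.0≢1+n (inj here (there x∈p) (sym eq))))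
    (λ x∈p y∈p → Finₚ.suc-injective ∘ inj (there x∈p) (there y∈p))

∣∁[∁p×∁q]∣ : (p : Subset m) (q : Subset n) → ∣ ∁ (∁ p ×ˢ ∁ q) ∣ ≡ m * n ∸ ∣ ∁ p ∣ * ∣ ∁ q ∣
∣∁[∁p×∁q]∣ {m} {n} p q = trans (∣∁p∣≡n∸∣p∣ (∁ p ×ˢ ∁ q)) (cong (m * n ∸_) (∣p×q∣≡∣p∣*∣q∣ (∁ p) (∁ q)))

-- Walks and distances

Undirected : Adj n → Set
Undirected {n} A = ∀ (u v : Fin n) → A u v ≡ A v u

Resolves : Adj n → Fin n → Fin n → Fin n → Set
Resolves A s x y = ∃₂ λ k l → Dist A s x k × Dist A s y l × k ≢ l

Homomorphism : Adj m → Adj n → (Fin m → Fin n) → Set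
Homomorphism A B f = ∀ {u v} → A u v ≡ true → B (f u) (f v) ≡ true

WeakHomomorphism : Adj m → Adj n → (Fin m → Fin n) → Set
WeakHomomorphism A B f = ∀ {u v} → A u v ≡ true → f u ≡ f v ⊎ B (f u) (f v) ≡ true

module _ {A : Adj n} where

  Walk-++ : ∀ {u w v k l} → Walk A u w k → Walk A w v l → Walk A u v (k + l)
  Walk-++ here       q = q
  Walk-++ (step e p) q = step e (Walk-++ p q)

  Walk-snoc : ∀ {u w v k} → Walk A u w k → A w v ≡ true → Walk A u v (suc k)
  Walk-snoc here       e′ = step e′ here
  Walk-snoc (step e p) e′ = step e (Walk-snoc p e′)

  Walk-reverse : Undirected A → ∀ {u v k} → Walk A u v k → Walk A v u k
  Walk-reverse undir-A here               = here
  Walk-reverse undir-A (step {u} {w} e p) = Walk-snoc (Walk-reverse undir-A p) (trans (undir-A w u) e)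

  Walk? : ∀ u v k → Dec (Walk A u v k)
  Walk? u v zero with u Fin.≟ v
  ... | yes refl = yes here
  ... | no u≢v   = no λ { here → u≢v refl }
  Walk? u v (suc k) with Finₚ.any? (λ w → (A u w Bool.≟ true) ×-dec Walk? w v k)
  ... | yes (w , e , p) = yes (step e p)
  ... | no ∄            = no λ { (step e p) → ∄ (_ , e , p) }

  Walk⇒Dist : ∀ {u v k} → Walk A u v k → ∃ (Dist A u v)
  Walk⇒Dist = least-witness (Walk? _ _)

  Connected⇒Dist : Connected A → ∀ u v → ∃ (Dist A u v)
  Connected⇒Dist conn u v = Walk⇒Dist (proj₂ (conn u v))

  Resolves-sym : ∀ {s x y} → Resolves A s x y → Resolves A s y x
  Resolves-sym (k , l , dk , dl , k≢l) = l , k , dl , dk , k≢l ∘ sym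

module _ {A : Adj m} {B : Adj n} {f : Fin m → Fin n} where

  Walk-map : Homomorphism A B f → ∀ {u v k} → Walk A u v k → Walk B (f u) (f v) k
  Walk-map hom here       = here
  Walk-map hom (step e p) = step (hom e) (Walk-map hom p)

  Walk-contract : WeakHomomorphism A B f → ∀ {u v k} → Walk A u v k →
                  ∃ λ l → l ≤ k × Walk B (f u) (f v) l
  Walk-contract weak here = 0 , z≤n , here
  Walk-contract weak (step e p) with Walk-contract weak p | weak e
  ... | l , l≤k , q | inj₁ fu≡fw = l , m≤n⇒m≤1+n l≤k , subst (λ z → Walk B z (f _) l) (sym fu≡fw) q
  ... | l , l≤k , q | inj₂ e′    = suc l , s≤s l≤k , step e′ q

  Dist-contract-≤ : WeakHomomorphism A B f → ∀ {u v k l} → Dist B (f u) (f v) l → Walk A u v k → l ≤ k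
  Dist-contract-≤ weak (_ , minimal) p with Walk-contract weak p
  ... | l , l≤k , q = ≤-trans (minimal l q) l≤k

Dist-retract : {A : Adj m} {B : Adj n} {f : Fin m → Fin n} {g : Fin n → Fin m} →
  Homomorphism A B f → WeakHomomorphism B A g → (∀ u → g (f u) ≡ u) →
  ∀ {u v k} → Dist A u v k → Dist B (f u) (f v) k
Dist-retract {A = A} hom weak g∘f {u} {v} {k} d@(p , _) =
  Walk-map hom p , λ l q → Dist-contract-≤ weak (subst₂ (λ x y → Dist A x y k) (sym (g∘f u)) (sym (g∘f v)) d) q

Walk-colour : {A : Adj n} (c : Fin n → Bool) → (∀ u v → A u v ≡ true → c u ≢ c v) →
  ∀ {u v k} → Walk A u v k → c v ≡ iterate not (c u) k
Walk-colour c proper here = refl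
Walk-colour c proper (step {u} {w} {k = k} e p) =
  trans (Walk-colour c proper p) (cong (λ b → iterate not b k) (¬-not (proper u w e ∘ sym)))

bipartite⇒singleton-generator : {A : Adj n} → Connected A → Bipartite A → ∀ v₀ → LocalMetricGen A ⁅ v₀ ⁆
bipartite⇒singleton-generator conn (c , proper) v₀ x y x~y
  with Connected⇒Dist conn v₀ x | Connected⇒Dist conn v₀ y
... | k , dk | l , dl = v₀ , x∈⁅x⁆ v₀ , k , l , dk , dl , λ { refl →
  proper x y x~y (trans (Walk-colour c proper (proj₁ dk)) (sym (Walk-colour c proper (proj₁ dl)))) }

-- True twins

TrueTwins : Adj n → Fin n → Fin n → Set
TrueTwins A u v = closedNbhd A u ≡ closedNbhd A v

module _ {A : Adj n} where

  TrueTwins⇒row : ∀ {u v} → TrueTwins A u v → ∀ w → ⌊ u Fin.≟ w ⌋ ∨ A u w ≡ ⌊ v Fin.≟ w ⌋ ∨ A v w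
  TrueTwins⇒row {u} {v} tw w = begin
    ⌊ u Fin.≟ w ⌋ ∨ A u w       ≡⟨ lookup∘tabulate _ w ⟨
    lookup (closedNbhd A u) w   ≡⟨ cong (λ N → lookup N w) tw ⟩
    lookup (closedNbhd A v) w   ≡⟨ lookup∘tabulate _ w ⟩
    ⌊ v Fin.≟ w ⌋ ∨ A v w       ∎
    where open ≡-Reasoning

  closed⁻ : ∀ {u v} → ⌊ u Fin.≟ v ⌋ ∨ A u v ≡ true → u ≡ v ⊎ A u v ≡ true
  closed⁻ {u} {v} e with u Fin.≟ v
  ... | yes u≡v = inj₁ u≡v
  ... | no _    = inj₂ e

  twins-adjacent : ∀ {x y} → TrueTwins A x y → x ≢ y → A x y ≡ true
  twins-adjacent {y = y} tw x≢y
    with closed⁻ (trans (TrueTwins⇒row tw y) (cong (_∨ A y y) (⌊≟⌋-refl y)))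
  ... | inj₁ x≡y = ⊥-elim (x≢y x≡y)
  ... | inj₂ x~y = x~y

  twin-walk : ∀ {x y s k} → TrueTwins A x y → x ≢ s → Walk A x s k → ∃ λ k′ → k′ ≤ k × Walk A y s k′
  twin-walk tw x≢s here = ⊥-elim (x≢s refl)
  twin-walk {x} tw x≢s (step {w = w} x~w p)
    with closed⁻ (trans (sym (TrueTwins⇒row tw w)) (trans (cong (⌊ x Fin.≟ w ⌋ ∨_) x~w) (∨-zeroʳ _)))
  ... | inj₁ refl = _ , n≤1+n _ , p
  ... | inj₂ y~w  = _ , ≤-refl , step y~w p

  twins-equidistant : Undirected A → ∀ {x y s k l} → TrueTwins A x y → s ≢ x → s ≢ y →
                      Dist A s x k → Dist A s y l → k ≡ l
  twins-equidistant undir-A tw s≢x s≢y dk dl = ≤-antisym (≤-twin tw s≢y dk dl) (≤-twin (sym tw) s≢x dl dk)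
    where
    ≤-twin : ∀ {x y s k l} → TrueTwins A x y → s ≢ y → Dist A s x k → Dist A s y l → k ≤ l
    ≤-twin tw s≢y (_ , minimal) (q , _) with twin-walk (sym tw) (s≢y ∘ sym) (Walk-reverse undir-A q)
    ... | j , j≤l , q′ = ≤-trans (minimal j (Walk-reverse undir-A q′)) j≤l

  generator-separates-twins : Undirected A → ∀ {S x y} → LocalMetricGen A S → TrueTwins A x y →
                              x ∉ S → y ∉ S → x ≡ y
  generator-separates-twins undir-A {x = x} {y} gen tw x∉S y∉S with x Fin.≟ y
  ... | yes x≡y = x≡y
  ... | no x≢y with gen x y (twins-adjacent tw x≢y)
  ...   | s , s∈S , k , l , dk , dl , k≢l =
    ⊥-elim (k≢l (twins-equidistant undir-A tw (λ { refl → x∉S s∈S }) (λ { refl → y∉S s∈S }) dk dl))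

  generator-size-≥ : Undirected A → (κ : Fin n → Fin m) {R : Subset m} →
    (∀ x → κ x ∈ R) → (∀ {x y} → κ x ≡ κ y → TrueTwins A x y) →
    ∀ {S} → LocalMetricGen A S → n ∸ ∣ R ∣ ≤ ∣ S ∣
  generator-size-≥ undir-A κ {R} κ∈R κ-twins {S} gen = begin
    n ∸ ∣ R ∣          ≤⟨ ∸-monoʳ-≤ n ∣∁S∣≤∣R∣ ⟩
    n ∸ ∣ ∁ S ∣        ≡⟨ cong (n ∸_) (∣∁p∣≡n∸∣p∣ S) ⟩
    n ∸ (n ∸ ∣ S ∣)    ≡⟨ m∸[m∸n]≡n (∣p∣≤n S) ⟩
    ∣ S ∣              ∎
    where
    open ≤-Reasoning
    ∣∁S∣≤∣R∣ : ∣ ∁ S ∣ ≤ ∣ R ∣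
    ∣∁S∣≤∣R∣ = injectiveOn⇒∣p∣≤∣q∣ κ (λ {x} _ → κ∈R x) λ x∈∁S y∈∁S κx≡κy →
      generator-separates-twins undir-A gen (κ-twins κx≡κy) (x∈∁p⇒x∉p x∈∁S) (x∈∁p⇒x∉p y∈∁S)

reps : Adj n → Subset n
reps A = tabulate (isClassRep A)

nonRep⇒earlierTwin : (A : Adj n) {u : Fin n} → isClassRep A u ≡ false →
  ∃ λ v → v Fin.< u × TrueTwins A v u
nonRep⇒earlierTwin {n} A {u} isNotRep
  with v , v<u∧twins ← satisfied (any⁻ _ (allFin n)
                          (Equivalence.from T-≡ (trans (sym (not-involutive _)) (cong not isNotRep))))
  with v<u , twins ← Equivalence.to T-∧ v<u∧twins
  = v , <ᵇ⇒< (toℕ v) (toℕ u) v<u , toWitness twins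

classRep : (A : Adj n) (u : Fin n) → Σ (Fin n) λ r → r ∈ reps A × TrueTwins A r u
classRep {n} A u = go (Finᵢ.<-wellFounded u)
  where
  go : ∀ {u} → Acc Fin._<_ u → Σ (Fin n) λ r → r ∈ reps A × TrueTwins A r u
  go {u} (acc earlier) with isClassRep A u in isRep
  ... | true  = u , lookup⇒[]= u (reps A) (trans (lookup∘tabulate _ u) isRep) , refl
  ... | false with v , v<u , v~u ← nonRep⇒earlierTwin A isRep =
    let r , r∈reps , r~v = go (earlier v<u) in r , r∈reps , trans r~v v~u

sameClassRep⇒TrueTwins : (A : Adj n) {u v : Fin n} →
  proj₁ (classRep A u) ≡ proj₁ (classRep A v) → TrueTwins A u v
sameClassRep⇒TrueTwins A {u} {v} eq =
  trans (sym (proj₂ (proj₂ (classRep A u)))) (trans (cong (closedNbhd A) eq) (proj₂ (proj₂ (classRep A v))))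

-- The strong product

module Product {n₁ n₂ : ℕ} (G : Adj n₁) (H : Adj n₂) where

  π₁ : Fin (n₁ * n₂) → Fin n₁
  π₁ i = proj₁ (remQuot n₂ i)

  π₂ : Fin (n₁ * n₂) → Fin n₂
  π₂ i = proj₂ (remQuot {n₁} n₂ i)

  π₁-combine : ∀ a b → π₁ (combine a b) ≡ a
  π₁-combine a b = cong proj₁ (Finₚ.remQuot-combine {n₁} a b)

  π₂-combine : ∀ a b → π₂ (combine a b) ≡ b
  π₂-combine a b = cong proj₂ (Finₚ.remQuot-combine {n₁} a b)

  combine-π : ∀ i → combine (π₁ i) (π₂ i) ≡ i
  combine-π = Finₚ.combine-remQuot {n₁} n₂

  π-injective : ∀ {i j} → π₁ i ≡ π₁ j → π₂ i ≡ π₂ j → i ≡ j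
  π-injective {i} {j} eq₁ eq₂ = trans (sym (combine-π i)) (trans (cong₂ combine eq₁ eq₂) (combine-π j))

  strongAdj : Fin n₁ → Fin n₂ → Fin n₁ → Fin n₂ → Bool
  strongAdj a b c d = (⌊ a Fin.≟ c ⌋ ∧ H b d) ∨ (⌊ b Fin.≟ d ⌋ ∧ G a c) ∨ (G a c ∧ H b d)

  ⊠-unfold : ∀ i j → (G ⊠ H) i j ≡ strongAdj (π₁ i) (π₂ i) (π₁ j) (π₂ j)
  ⊠-unfold i j with remQuot {n₁} n₂ i | remQuot {n₁} n₂ j
  ... | _ | _ = refl

  ⊠-combine : ∀ a b c d → (G ⊠ H) (combine a b) (combine c d) ≡ strongAdj a b c d
  ⊠-combine a b c d = trans (⊠-unfold (combine a b) (combine c d))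
    (cong₂ (λ x y → strongAdj (proj₁ x) (proj₂ x) (proj₁ y) (proj₂ y))
           (Finₚ.remQuot-combine a b) (Finₚ.remQuot-combine c d))

  ⌊≟⌋-π : ∀ i j → ⌊ i Fin.≟ j ⌋ ≡ ⌊ π₁ i Fin.≟ π₁ j ⌋ ∧ ⌊ π₂ i Fin.≟ π₂ j ⌋
  ⌊≟⌋-π i j with π₁ i Fin.≟ π₁ j | π₂ i Fin.≟ π₂ j
  ... | yes eq₁ | yes eq₂ rewrite π-injective eq₁ eq₂ = ⌊≟⌋-refl j
  ... | yes _   | no ne₂  = ⌊≟⌋-≢ (ne₂ ∘ cong π₂)
  ... | no ne₁  | _       = ⌊≟⌋-≢ (ne₁ ∘ cong π₁)

  closed-⊠ : ∀ i j → ⌊ i Fin.≟ j ⌋ ∨ (G ⊠ H) i j ≡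
    (⌊ π₁ i Fin.≟ π₁ j ⌋ ∨ G (π₁ i) (π₁ j)) ∧ (⌊ π₂ i Fin.≟ π₂ j ⌋ ∨ H (π₂ i) (π₂ j))
  closed-⊠ i j = trans (cong₂ _∨_ (⌊≟⌋-π i j) (⊠-unfold i j))
    (factor ⌊ π₁ i Fin.≟ π₁ j ⌋ ⌊ π₂ i Fin.≟ π₂ j ⌋ (G (π₁ i) (π₁ j)) (H (π₂ i) (π₂ j)))
    where
    open ∨-∧-Solver
    factor : ∀ p q g h → (p ∧ q) ∨ ((p ∧ h) ∨ (q ∧ g) ∨ (g ∧ h)) ≡ (p ∨ g) ∧ (q ∨ h)
    factor = solve 4 (λ p q g h → (p :* q) :+ ((p :* h) :+ ((q :* g) :+ (g :* h))) := (p :+ g) :* (q :+ h)) refl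

  ⊠-adjacent⁻ : ∀ {i j} → (G ⊠ H) i j ≡ true →
    (⌊ π₁ i Fin.≟ π₁ j ⌋ ∨ G (π₁ i) (π₁ j)) ≡ true × (⌊ π₂ i Fin.≟ π₂ j ⌋ ∨ H (π₂ i) (π₂ j)) ≡ true
  ⊠-adjacent⁻ {i} {j} i~j = ∧≡true⁻ (trans (sym (closed-⊠ i j)) (trans (cong (⌊ i Fin.≟ j ⌋ ∨_) i~j) (∨-zeroʳ _)))

  π₁-weakHom : WeakHomomorphism (G ⊠ H) G π₁
  π₁-weakHom = closed⁻ {A = G} ∘ proj₁ ∘ ⊠-adjacent⁻

  π₂-weakHom : WeakHomomorphism (G ⊠ H) H π₂
  π₂-weakHom = closed⁻ {A = H} ∘ proj₂ ∘ ⊠-adjacent⁻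

  fibre₁-hom : ∀ b → Homomorphism G (G ⊠ H) (λ a → combine a b)
  fibre₁-hom b {a} {c} a~c rewrite ⊠-combine a b c b | ⌊≟⌋-refl b | a~c = ∨-zeroʳ _

  fibre₂-hom : ∀ a → Homomorphism H (G ⊠ H) (combine a)
  fibre₂-hom a {b} {d} b~d rewrite ⊠-combine a b a d | ⌊≟⌋-refl a | b~d = refl

  ⊠-simple : SimpleGraph G → SimpleGraph H → SimpleGraph (G ⊠ H)
  ⊠-simple (undir-G , loopless-G) (undir-H , loopless-H) = ⊠-undirected , ⊠-loopless
    where
    ⊠-undirected : Undirected (G ⊠ H)
    ⊠-undirected i j rewrite ⊠-unfold i j | ⊠-unfold j i
      | ⌊≟⌋-sym (π₁ i) (π₁ j) | ⌊≟⌋-sym (π₂ i) (π₂ j) | undir-G (π₁ i) (π₁ j) | undir-H (π₂ i) (π₂ j) = refl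
    ⊠-loopless : ∀ i → (G ⊠ H) i i ≡ false
    ⊠-loopless i rewrite ⊠-unfold i i
      | ⌊≟⌋-refl (π₁ i) | ⌊≟⌋-refl (π₂ i) | loopless-G (π₁ i) | loopless-H (π₂ i) = refl

  ⊠-connected : Connected G → Connected H → Connected (G ⊠ H)
  ⊠-connected conn-G conn-H i j with conn-G (π₁ i) (π₁ j) | conn-H (π₂ i) (π₂ j)
  ... | k , p | l , q = k + l , subst₂ (λ x y → Walk (G ⊠ H) x y (k + l)) (combine-π i) (combine-π j)
    (Walk-++ (Walk-map (fibre₁-hom (π₂ i)) p) (Walk-map (fibre₂-hom (π₁ j)) q))

  ⊠-twins : ∀ {i j} → TrueTwins G (π₁ i) (π₁ j) → TrueTwins H (π₂ i) (π₂ j) → TrueTwins (G ⊠ H) i j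
  ⊠-twins {i} {j} tw₁ tw₂ = tabulate-cong λ w →
    trans (closed-⊠ i w)
      (trans (cong₂ _∧_ (TrueTwins⇒row {A = G} {π₁ i} {π₁ j} tw₁ (π₁ w)) (TrueTwins⇒row {A = H} {π₂ i} {π₂ j} tw₂ (π₂ w)))
             (sym (closed-⊠ j w)))

  Dist-fibre₁ : ∀ {s i k} → Dist G s (π₁ i) k → Dist (G ⊠ H) (combine s (π₂ i)) i k
  Dist-fibre₁ {s} {i} {k} d = subst (λ x → Dist (G ⊠ H) (combine s (π₂ i)) x k) (combine-π i)
    (Dist-retract (fibre₁-hom (π₂ i)) π₁-weakHom (λ a → π₁-combine a (π₂ i)) d)

  Dist-fibre₂ : ∀ {t i k} → Dist H t (π₂ i) k → Dist (G ⊠ H) (combine (π₁ i) t) i k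
  Dist-fibre₂ {t} {i} {k} d = subst (λ x → Dist (G ⊠ H) (combine (π₁ i) t) x k) (combine-π i)
    (Dist-retract (fibre₂-hom (π₁ i)) π₂-weakHom (π₂-combine (π₁ i)) d)

  ⊠-resolves₂ : ∀ {t i j} → π₁ i ≡ π₁ j → Resolves H t (π₂ i) (π₂ j) → Resolves (G ⊠ H) (combine (π₁ i) t) i j
  ⊠-resolves₂ {t} {j = j} π₁i≡π₁j (k , l , dk , dl , k≢l) =
    k , l , Dist-fibre₂ dk , subst (λ a → Dist (G ⊠ H) (combine a t) j l) (sym π₁i≡π₁j) (Dist-fibre₂ dl) , k≢l

  module _ (conn-G : Connected G) (conn-H : Connected H) where

    -- (s , π₂ i) is at distance k from i, while projecting a walk to j onto G shows it has length ≥ l.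
    ⊠-resolves-closer : ∀ {s i j k l} → Dist G s (π₁ i) k → Dist G s (π₁ j) l → k < l →
                        Resolves (G ⊠ H) (combine s (π₂ i)) i j
    ⊠-resolves-closer {s} {i} {j} {l = l} dk dl k<l
      with L , dL ← Connected⇒Dist (⊠-connected conn-G conn-H) (combine s (π₂ i)) j =
      _ , L , Dist-fibre₁ dk , dL , <⇒≢ (<-≤-trans k<l (Dist-contract-≤ π₁-weakHom dl′ (proj₁ dL)))
      where
      dl′ : Dist G (π₁ (combine s (π₂ i))) (π₁ j) l
      dl′ = subst (λ a → Dist G a (π₁ j) l) (sym (π₁-combine s (π₂ i))) dl

    ⊠-resolves₁ : ∀ {s i j} → Resolves G s (π₁ i) (π₁ j) → ∃ λ b → Resolves (G ⊠ H) (combine s b) i j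
    ⊠-resolves₁ (k , l , dk , dl , k≢l) with <-cmp k l
    ... | tri< k<l _ _ = _ , ⊠-resolves-closer dk dl k<l
    ... | tri≈ _ k≡l _ = ⊥-elim (k≢l k≡l)
    ... | tri> _ _ l<k = _ , Resolves-sym (⊠-resolves-closer dl dk l<k)

    -- ∁ (∁ SG ×ˢ ∁ SH) = {(a , b) ∣ a ∈ SG or b ∈ SH}
    ⊠-generator : SimpleGraph G → SimpleGraph H →
      ∀ {SG SH} → LocalMetricGen G SG → LocalMetricGen H SH → LocalMetricGen (G ⊠ H) (∁ (∁ SG ×ˢ ∁ SH))
    ⊠-generator simple-G simple-H {SG} {SH} gen-G gen-H i j i~j
      with π₁-weakHom i~j | π₂-weakHom i~j
    ... | inj₂ G-edge | _ with s , s∈SG , resolves ← gen-G _ _ G-edge =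
      let b , resolves′ = ⊠-resolves₁ resolves in
      combine s b , x∈p⇒combine∈∁[∁p×∁q] {q = SH} s∈SG , resolves′
    ... | inj₁ π₁i≡π₁j | inj₂ H-edge with t , t∈SH , resolves ← gen-H _ _ H-edge =
      combine (π₁ i) t , y∈q⇒combine∈∁[∁p×∁q] {p = SG} t∈SH , ⊠-resolves₂ π₁i≡π₁j resolves
    ... | inj₁ π₁i≡π₁j | inj₁ π₂i≡π₂j with refl ← π-injective π₁i≡π₁j π₂i≡π₂j
      with () ← trans (sym (proj₂ (⊠-simple simple-G simple-H) i)) i~j

  ⊠-generator-size-≥ : SimpleGraph G → SimpleGraph H → ∀ {S} → LocalMetricGen (G ⊠ H) S →
                       n₁ * n₂ ∸ trueTwinClasses G * trueTwinClasses H ≤ ∣ S ∣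
  ⊠-generator-size-≥ simple-G simple-H gen =
    subst (λ r → n₁ * n₂ ∸ r ≤ _) (∣p×q∣≡∣p∣*∣q∣ (reps G) (reps H))
      (generator-size-≥ (proj₁ (⊠-simple simple-G simple-H)) κ κ∈reps×reps κ-twins gen)
    where
    ρ₁ : Fin n₁ → Fin n₁
    ρ₁ = proj₁ ∘ classRep G
    ρ₂ : Fin n₂ → Fin n₂
    ρ₂ = proj₁ ∘ classRep H
    κ : Fin (n₁ * n₂) → Fin (n₁ * n₂)
    κ i = combine (ρ₁ (π₁ i)) (ρ₂ (π₂ i))
    κ∈reps×reps : ∀ i → κ i ∈ reps G ×ˢ reps H
    κ∈reps×reps i = x∈p×q⁺ (proj₁ (proj₂ (classRep G (π₁ i)))) (proj₁ (proj₂ (classRep H (π₂ i))))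
    κ-twins : ∀ {i j} → κ i ≡ κ j → TrueTwins (G ⊠ H) i j
    κ-twins {i} {j} κi≡κj
      with ρ₁≡ , ρ₂≡ ← Finₚ.combine-injective (ρ₁ (π₁ i)) (ρ₂ (π₂ i)) (ρ₁ (π₁ j)) (ρ₂ (π₂ j)) κi≡κj =
      ⊠-twins (sameClassRep⇒TrueTwins G ρ₁≡) (sameClassRep⇒TrueTwins H ρ₂≡)

  module _ (simple-G : SimpleGraph G) (simple-H : SimpleGraph H)
           (conn-G : Connected G) (conn-H : Connected H) where

    ⊠-dim-of-extremal-factors :
      IsLocalMetricDim G (n₁ ∸ trueTwinClasses G) → IsLocalMetricDim H (n₂ ∸ trueTwinClasses H) →
      IsLocalMetricDim (G ⊠ H) (n₁ * n₂ ∸ trueTwinClasses G * trueTwinClasses H)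
    ⊠-dim-of-extremal-factors ((SG , gen-G , ∣SG∣) , _) ((SH , gen-H , ∣SH∣) , _) =
      (∁ (∁ SG ×ˢ ∁ SH) , ⊠-generator conn-G conn-H simple-G simple-H gen-G gen-H , size) ,
      λ _ → ⊠-generator-size-≥ simple-G simple-H
      where
      size : ∣ ∁ (∁ SG ×ˢ ∁ SH) ∣ ≡ n₁ * n₂ ∸ trueTwinClasses G * trueTwinClasses H
      size = trans (∣∁[∁p×∁q]∣ SG SH)
        (cong₂ (λ a b → n₁ * n₂ ∸ a * b) (∣p∣≡n∸t⇒∣∁p∣≡t SG ∣SG∣ (∣p∣≤n (reps G)))
                                         (∣p∣≡n∸t⇒∣∁p∣≡t SH ∣SH∣ (∣p∣≤n (reps H))))

    ⊠-dim-bipartite-bounds : 1 ≤ n₂ →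
      IsLocalMetricDim G (n₁ ∸ trueTwinClasses G) → Bipartite H → ∀ {d} → IsLocalMetricDim (G ⊠ H) d →
      n₂ * (n₁ ∸ trueTwinClasses G) ≤ d × d ≤ n₂ * (n₁ ∸ trueTwinClasses G) + trueTwinClasses G
    ⊠-dim-bipartite-bounds 1≤n₂ ((SG , gen-G , ∣SG∣) , _) bipartite-H ((S , gen , refl) , minimal) =
      lower , upper
      where
      t₁≤n₁ : trueTwinClasses G ≤ n₁
      t₁≤n₁ = ∣p∣≤n (reps G)
      b₀ : Fin n₂
      b₀ = fromℕ< 1≤n₂
      lower : n₂ * (n₁ ∸ trueTwinClasses G) ≤ ∣ S ∣
      lower = ≤-trans (n*[m∸o]≤m*n∸o*p n₁ n₂ (trueTwinClasses G) _ (∣p∣≤n (reps H)))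
                      (⊠-generator-size-≥ simple-G simple-H gen)
      upper : ∣ S ∣ ≤ n₂ * (n₁ ∸ trueTwinClasses G) + trueTwinClasses G
      upper = begin
        ∣ S ∣
          ≤⟨ minimal _ (⊠-generator conn-G conn-H simple-G simple-H gen-G
                          (bipartite⇒singleton-generator conn-H bipartite-H b₀)) ⟩
        ∣ ∁ (∁ SG ×ˢ ∁ ⁅ b₀ ⁆) ∣
          ≡⟨ ∣∁[∁p×∁q]∣ SG ⁅ b₀ ⁆ ⟩
        n₁ * n₂ ∸ ∣ ∁ SG ∣ * ∣ ∁ ⁅ b₀ ⁆ ∣
          ≡⟨ cong₂ (λ a b → n₁ * n₂ ∸ a * b) (∣p∣≡n∸t⇒∣∁p∣≡t SG ∣SG∣ t₁≤n₁)
                   (trans (∣∁p∣≡n∸∣p∣ ⁅ b₀ ⁆) (cong (n₂ ∸_) (∣⁅x⁆∣≡1 b₀))) ⟩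
        n₁ * n₂ ∸ trueTwinClasses G * (n₂ ∸ 1)
          ≡⟨ m*n∸o*[n∸1]≡n*[m∸o]+o n₁ n₂ _ t₁≤n₁ 1≤n₂ ⟩
        n₂ * (n₁ ∸ trueTwinClasses G) + trueTwinClasses G
          ∎
        where open ≤-Reasoning

open Product

theorem11 : (n₁ n₂ : ℕ) (G : Adj n₁) (H : Adj n₂) →
    SimpleGraph G → SimpleGraph H → 2 ≤ n₁ → 2 ≤ n₂ →
    Connected G → Connected H →
    (IsLocalMetricDim G (n₁ ∸ trueTwinClasses G) →
      IsLocalMetricDim H (n₂ ∸ trueTwinClasses H) →
      IsLocalMetricDim (G ⊠ H) (n₁ * n₂ ∸ trueTwinClasses G * trueTwinClasses H))
    × (IsLocalMetricDim G (n₁ ∸ trueTwinClasses G) → Bipartite H →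
      (d : ℕ) → IsLocalMetricDim (G ⊠ H) d →
      (n₂ * (n₁ ∸ trueTwinClasses G) ≤ d)
        × (d ≤ n₂ * (n₁ ∸ trueTwinClasses G) + trueTwinClasses G))
theorem11 n₁ n₂ G H simple-G simple-H _ 2≤n₂ conn-G conn-H =
  ⊠-dim-of-extremal-factors G H simple-G simple-H conn-G conn-H ,
  λ dim-G bipartite-H _ →
    ⊠-dim-bipartite-bounds G H simple-G simple-H conn-G conn-H (≤-trans (s≤s z≤n) 2≤n₂) dim-G bipartite-H
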